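{- Let $n\geq 3$ be an integer and let $C_n\Box C_n$ be the Cartesian product of two cycles of length $n$, with the constant threshold $2$ at every vertex. Then $mon_2(C_n\Box C_n)=\dfrac{n^2}{3}$ if $n=3t$ for an integer $t$; $mon_2(C_n\Box C_n)\leq \dfrac{(n-1)(n+3)}{3}$ if $n=3t+1$ for an integer $t$; $mon_2(C_n\Box C_n)\leq \dfrac{(n+1)^2}{3}-1$ if $n=3t+2$ for an integer $t$.
   Context: All graphs are simple and undirected. The Cartesian product $G\Box H$ has vertex set $V(G)\times V(H)$, with $(u,v)$ adjacent to $(u',v')$ iff either $u=u'$ and $vv'\in E(H)$, or $v=v'$ and $uu'\in E(G)$. For a graph $G$ and a function $\tau:V(G)\to\mathbb{N}$ with $\tau(v)\le d_G(v)$, a set $M\subseteq V(G)$ is a $\tau$-monopoly if every vertex $v\in V(G)\setminus M$ has at least $\tau(v)$ neighbors in $M$; $mon_\tau(G)$ is the minimum size of a $\tau$-monopoly. When $\tau$ is constantly equal to $t$ one writes $mon_t(G)$. -}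

module Defs where

open import Data.Nat using (ℕ; zero; suc; _≤_)
open import Data.Nat.Properties using (_≟_)
open import Data.Fin using (Fin; toℕ; remQuot)
open import Data.Fin.Subset using (Subset; _∈_; _∉_; _∩_; ∣_∣)
open import Data.Vec using (tabulate)
open import Data.Bool using (Bool)
open import Data.Product using (Σ; _×_; _,_; proj₁; proj₂)
open import Data.Sum using (_⊎_)
open import Relation.Nullary using (Dec; does)
open import Relation.Nullary.Decidable using (_⊎-dec_; _×-dec_)
open import Relation.Binary.PropositionalEquality using (_≡_)

record Graph : Set₁ where
  field
    order : ℕ
    Adj   : Fin order → Fin order → Set
    adj?  : (u v : Fin order) → Dec (Adj u v)
open Graph public

Nbhd : (G : Graph) → Fin (order G) → Subset (order G)
Nbhd G v = tabulate (λ u → does (adj? G v u))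

deg : (G : Graph) → Fin (order G) → ℕ
deg G v = ∣ Nbhd G v ∣

CAdj : (n : ℕ) → Fin n → Fin n → Set
CAdj n i j =
  (toℕ j ≡ suc (toℕ i)) ⊎ (toℕ i ≡ suc (toℕ j))
  ⊎ ((toℕ i ≡ 0) × (suc (toℕ j) ≡ n)) ⊎ ((toℕ j ≡ 0) × (suc (toℕ i) ≡ n))

cycle : ℕ → Graph
cycle n = record
  { order = n
  ; Adj = CAdj n
  ; adj? = λ i j →
      (toℕ j ≟ suc (toℕ i)) ⊎-dec (toℕ i ≟ suc (toℕ j))
      ⊎-dec ((toℕ i ≟ 0) ×-dec (suc (toℕ j) ≟ n))
      ⊎-dec ((toℕ j ≟ 0) ×-dec (suc (toℕ i) ≟ n))
  }

-- Cartesian product G □ H; vertex set Fin (|G| * |H|) ≅ V(G) × V(H) via remQuot.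
□Adj : (G H : Graph) → Fin (order G Data.Nat.* order H) → Fin (order G Data.Nat.* order H) → Set
□Adj G H x y =
  ((proj₁ p ≡ proj₁ q) × Adj H (proj₂ p) (proj₂ q))
  ⊎ ((proj₂ p ≡ proj₂ q) × Adj G (proj₁ p) (proj₁ q))
  where
  p = remQuot {order G} (order H) x
  q = remQuot {order G} (order H) y

_□_ : Graph → Graph → Graph
G □ H = record
  { order = order G Data.Nat.* order H
  ; Adj = □Adj G H
  ; adj? = λ x y →
      let p = remQuot {order G} (order H) x
          q = remQuot {order G} (order H) y
      in ((proj₁ p Data.Fin.≟ proj₁ q) ×-dec adj? H (proj₂ p) (proj₂ q))
         ⊎-dec ((proj₂ p Data.Fin.≟ proj₂ q) ×-dec adj? G (proj₁ p) (proj₁ q))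
  }

IsMonopoly : (G : Graph) → (Fin (order G) → ℕ) → Subset (order G) → Set
IsMonopoly G τ M = ∀ v → v ∉ M → τ v ≤ ∣ M ∩ Nbhd G v ∣

-- mon_τ(G) = m : some τ-monopoly has size m and every τ-monopoly has size ≥ m.
MonEq : (G : Graph) → (Fin (order G) → ℕ) → ℕ → Set
MonEq G τ m =
  Σ (Subset (order G)) (λ M → IsMonopoly G τ M × ∣ M ∣ ≡ m)
  × (∀ M → IsMonopoly G τ M → m ≤ ∣ M ∣)

-- mon_τ(G) ≤ k : some τ-monopoly has size at most k.
MonLe : (G : Graph) → (Fin (order G) → ℕ) → ℕ → Set
MonLe G τ k = Σ (Subset (order G)) (λ M → IsMonopoly G τ M × ∣ M ∣ ≤ k)

const : (G : Graph) → ℕ → Fin (order G) → ℕ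
const G t _ = t

-- Lower bound: every vertex outside a 2-monopoly M has at least two neighbours in M and
-- every vertex of M has at most four neighbours, so counting the edges between M and its
-- complement gives 2 (n² − |M|) ≤ 4 |M|, that is n² ≤ 3 |M|.
--
-- Upper bound: write n = 3t + e. The vertices (i, j) with i + j ≡ 1 (mod 3) form a 2-monopoly
-- when e = 0; otherwise the pattern breaks where the torus wraps around, and this is repaired
-- by adding the vertices (0, j) and (j, 0) with 3 ∣ j ≠ 0 when e = 1, and with j ≡ 2 (mod 3)
-- when e = 2. Whether a vertex or one of its four neighbours lies in this set depends only on
-- the residues of the coordinates and on which of them equal 0, 1 or n − 1, so the monopoly
-- property is a finite check, settled by evaluation. Counting the set by periodicity of the
-- residues gives exactly the three stated bounds.
module Submission where

open import Defs
open import Data.Bool using (Bool; true; false; _∧_; _∨_; not; T; if_then_else_)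
open import Data.Bool.Properties using (T-≡; ∧-identityʳ)
open import Data.Fin using (Fin; zero; suc; toℕ; fromℕ; fromℕ<; inject₁; remQuot; combine; _↑ˡ_; _↑ʳ_)
import Data.Fin.Properties as Finₚ
open import Data.Fin.Subset using (Subset; _∉_; _∩_; ∁; ∣_∣)
open import Data.Fin.Subset.Properties using (∣∁p∣≡n∸∣p∣; ∣p∣≤n)
open import Data.List using (List; []; _∷_)
import Data.List as List
open import Data.List.Membership.Propositional using () renaming (_∈_ to _∈ˡ_)
open import Data.List.Properties using (map-cong-local)
open import Data.List.Relation.Unary.All using (All; []; _∷_)
import Data.List.Relation.Unary.All as All
open import Data.List.Relation.Unary.AllPairs using ([]; _∷_)
open import Data.List.Relation.Unary.Any using (here; there)
open import Data.List.Relation.Unary.Unique.Propositional using (Unique)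
open import Data.Nat using (ℕ; zero; suc; _+_; _*_; _∸_; _≤_; _<_; z≤n; s≤s; _≡ᵇ_; _≤ᵇ_; _%_; _/_; _<?_)
open import Data.Nat.DivMod using (_mod_; m%n<n; %-distribˡ-+; [m+n]%n≡m%n; [m+kn]%n≡m%n; m*n/n≡m; /-monoˡ-≤)
open import Data.Nat.ListAction using () renaming (sum to sumˡ)
open import Data.Nat.Properties
open import Algebra.Properties.Semiring.Sum +-*-semiring
  using (sum; sum-syntax; sum-cong-≗; ∑-distrib-+; ∑-comm; *-distribˡ-sum; *-distribʳ-sum; sum-replicate-zero)
open import Data.Nat.Tactic.RingSolver using (solve-∀)
open import Data.Product using (_×_; _,_; proj₁; proj₂)
open import Data.Sum using (_⊎_; inj₁; inj₂)
open import Data.Vec using ([]; _∷_; lookup; tabulate)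
open import Data.Vec.Properties using (lookup-zipWith; lookup∘tabulate; lookup-map; []=⇒lookup; lookup⇒[]=)
open import Function using (_∘_; case_of_; Equivalence)
open import Relation.Binary.PropositionalEquality
open import Relation.Nullary using (does; yes; no; Dec; ¬_; contradiction)
open import Relation.Nullary.Decidable using (dec-true; dec-false; from-yes; T?)

-- Finite sums

⟦_⟧ : Bool → ℕ
⟦ true ⟧ = 1
⟦ false ⟧ = 0

⟦∧⟧ : ∀ x y → ⟦ x ∧ y ⟧ ≡ ⟦ x ⟧ * ⟦ y ⟧
⟦∧⟧ true y = sym (+-identityʳ ⟦ y ⟧)
⟦∧⟧ false y = refl

⟦∨⟧≤ : ∀ x y → ⟦ x ∨ y ⟧ ≤ ⟦ x ⟧ + ⟦ y ⟧
⟦∨⟧≤ true y = s≤s z≤n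
⟦∨⟧≤ false y = ≤-refl

sum-mono-≤ : ∀ {n} {f g : Fin n → ℕ} → (∀ i → f i ≤ g i) → sum f ≤ sum g
sum-mono-≤ {zero} f≤g = z≤n
sum-mono-≤ {suc n} f≤g = +-mono-≤ (f≤g zero) (sum-mono-≤ (f≤g ∘ suc))

∑-const : ∀ n c → ∑[ i < n ] c ≡ n * c
∑-const zero c = refl
∑-const (suc n) c = cong (c +_) (∑-const n c)

∑-δ : ∀ {n} (v : Fin n) (f : Fin n → ℕ) → ∑[ u < n ] (⟦ does (u Finₚ.≟ v) ⟧ * f u) ≡ f v
∑-δ {suc n} zero f = trans (cong (f zero + 0 +_) (sum-replicate-zero n)) (trans (+-identityʳ _) (+-identityʳ _))
∑-δ {suc n} (suc v) f = ∑-δ v (f ∘ suc)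

∑-split-at : ∀ {n} (v : Fin n) (f : Fin n → ℕ) →
  sum f ≡ f v + ∑[ u < n ] (⟦ not (does (u Finₚ.≟ v)) ⟧ * f u)
∑-split-at {n} v f = begin
  sum f
    ≡⟨ sum-cong-≗ (λ u → split (does (u Finₚ.≟ v)) (f u)) ⟩
  ∑[ u < n ] (⟦ does (u Finₚ.≟ v) ⟧ * f u + ⟦ not (does (u Finₚ.≟ v)) ⟧ * f u)
    ≡⟨ ∑-distrib-+ (λ u → ⟦ does (u Finₚ.≟ v) ⟧ * f u) (λ u → ⟦ not (does (u Finₚ.≟ v)) ⟧ * f u) ⟩
  ∑[ u < n ] (⟦ does (u Finₚ.≟ v) ⟧ * f u) + ∑[ u < n ] (⟦ not (does (u Finₚ.≟ v)) ⟧ * f u)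
    ≡⟨ cong (_+ ∑[ u < n ] (⟦ not (does (u Finₚ.≟ v)) ⟧ * f u)) (∑-δ v f) ⟩
  f v + ∑[ u < n ] (⟦ not (does (u Finₚ.≟ v)) ⟧ * f u) ∎
  where
  open ≡-Reasoning
  split : ∀ b x → x ≡ ⟦ b ⟧ * x + ⟦ not b ⟧ * x
  split true x = sym (trans (+-identityʳ (x + 0)) (+-identityʳ x))
  split false x = sym (+-identityʳ x)

sum-unique≤∑ : ∀ {n} (f : Fin n → ℕ) {ws : List (Fin n)} → Unique ws → sumˡ (List.map f ws) ≤ sum f
sum-unique≤∑ f [] = z≤n
sum-unique≤∑ {n} f {w ∷ ws} (w∉ws ∷ unique) = begin
  f w + sumˡ (List.map f ws)   ≡⟨ cong (λ xs → f w + sumˡ xs) (map-cong-local (All.map unmasked w∉ws)) ⟩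
  f w + sumˡ (List.map fʷ ws)  ≤⟨ +-monoʳ-≤ (f w) (sum-unique≤∑ fʷ unique) ⟩
  f w + sum fʷ                 ≡⟨ sym (∑-split-at w f) ⟩
  sum f                        ∎
  where
  open ≤-Reasoning
  fʷ : Fin n → ℕ
  fʷ u = ⟦ not (does (u Finₚ.≟ w)) ⟧ * f u
  unmasked : ∀ {u} → ¬ w ≡ u → f u ≡ fʷ u
  unmasked {u} w≢u rewrite dec-false (u Finₚ.≟ w) (w≢u ∘ sym) = sym (+-identityʳ (f u))

∑-↑ : ∀ m n (f : Fin (m + n) → ℕ) → sum f ≡ ∑[ i < m ] f (i ↑ˡ n) + ∑[ j < n ] f (m ↑ʳ j)
∑-↑ zero n f = refl
∑-↑ (suc m) n f = trans (cong (f zero +_) (∑-↑ m n (f ∘ suc))) (sym (+-assoc (f zero) _ _))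

∑-combine : ∀ m k (f : Fin (m * k) → ℕ) → sum f ≡ ∑[ a < m ] ∑[ b < k ] f (combine a b)
∑-combine zero k f = refl
∑-combine (suc m) k f =
  trans (∑-↑ k (m * k) f) (cong (∑[ b < k ] f (b ↑ˡ m * k) +_) (∑-combine m k (f ∘ (k ↑ʳ_))))

∑-remQuot : ∀ m k (g : Fin m × Fin k → ℕ) → ∑[ x < m * k ] g (remQuot k x) ≡ ∑[ a < m ] ∑[ b < k ] g (a , b)
∑-remQuot m k g = trans (∑-combine m k (g ∘ remQuot k))
  (sum-cong-≗ λ a → sum-cong-≗ λ b → cong g (Finₚ.remQuot-combine a b))

∑-periodic : ∀ p (h : ℕ → ℕ) → (∀ k → h (p + k) ≡ h k) → ∀ t e →
  ∑[ i < p * t + e ] h (toℕ i) ≡ t * ∑[ i < p ] h (toℕ i) + ∑[ i < e ] h (toℕ i)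
∑-periodic p h periodic zero e = cong (λ m → ∑[ i < m ] h (toℕ i)) (cong (_+ e) (*-zeroʳ p))
∑-periodic p h periodic (suc t) e = begin
  ∑[ i < p * suc t + e ] h (toℕ i)
    ≡⟨ cong (λ m → ∑[ i < m ] h (toℕ i)) (trans (cong (_+ e) (*-suc p t)) (+-assoc p (p * t) e)) ⟩
  ∑[ i < p + (p * t + e) ] h (toℕ i)
    ≡⟨ ∑-↑ p (p * t + e) (h ∘ toℕ) ⟩
  ∑[ i < p ] h (toℕ (i ↑ˡ (p * t + e))) + ∑[ j < p * t + e ] h (toℕ (p ↑ʳ j))
    ≡⟨ cong₂ _+_ (sum-cong-≗ {p} λ i → cong h (Finₚ.toℕ-↑ˡ i (p * t + e)))
                 (sum-cong-≗ {p * t + e} λ j → trans (cong h (Finₚ.toℕ-↑ʳ p j)) (periodic (toℕ j))) ⟩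
  P + ∑[ j < p * t + e ] h (toℕ j)
    ≡⟨ cong (P +_) (∑-periodic p h periodic t e) ⟩
  P + (t * P + ∑[ i < e ] h (toℕ i))
    ≡⟨ sym (+-assoc P (t * P) _) ⟩
  suc t * P + ∑[ i < e ] h (toℕ i) ∎
  where
  open ≡-Reasoning
  P = ∑[ i < p ] h (toℕ i)

∣p∣≡∑ : ∀ {n} (p : Subset n) → ∣ p ∣ ≡ ∑[ i < n ] ⟦ lookup p i ⟧
∣p∣≡∑ [] = refl
∣p∣≡∑ (true ∷ p) = cong suc (∣p∣≡∑ p)
∣p∣≡∑ (false ∷ p) = ∣p∣≡∑ p

∉⇒lookup≡false : ∀ {n} {p : Subset n} {v} → v ∉ p → lookup p v ≡ false
∉⇒lookup≡false {p = p} {v} v∉p with lookup p v in p[v]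
... | true = contradiction (lookup⇒[]= v p p[v]) v∉p
... | false = refl

-- Monopolies in graphs of bounded degree

edge : (G : Graph) → Fin (order G) → Fin (order G) → ℕ
edge G u v = ⟦ does (adj? G u v) ⟧

lookup-∩-Nbhd : (G : Graph) (M : Subset (order G)) {v w : Fin (order G)} →
  Adj G v w → lookup (M ∩ Nbhd G v) w ≡ lookup M w
lookup-∩-Nbhd G M {v} {w} v~w = begin
  lookup (M ∩ Nbhd G v) w            ≡⟨ lookup-zipWith _∧_ w M (Nbhd G v) ⟩
  lookup M w ∧ lookup (Nbhd G v) w   ≡⟨ cong (lookup M w ∧_) (lookup∘tabulate _ w) ⟩
  lookup M w ∧ does (adj? G v w)     ≡⟨ cong (lookup M w ∧_) (dec-true (adj? G v w) v~w) ⟩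
  lookup M w ∧ true                  ≡⟨ ∧-identityʳ (lookup M w) ⟩
  lookup M w                         ∎
  where open ≡-Reasoning

∣M∩Nbhd∣≡∑ : (G : Graph) (M : Subset (order G)) (v : Fin (order G)) →
  ∣ M ∩ Nbhd G v ∣ ≡ ∑[ u < order G ] (edge G v u * ⟦ lookup M u ⟧)
∣M∩Nbhd∣≡∑ G M v = trans (∣p∣≡∑ (M ∩ Nbhd G v)) (sum-cong-≗ λ u → begin
  ⟦ lookup (M ∩ Nbhd G v) u ⟧            ≡⟨ cong ⟦_⟧ (lookup-zipWith _∧_ u M (Nbhd G v)) ⟩
  ⟦ lookup M u ∧ lookup (Nbhd G v) u ⟧   ≡⟨ cong (λ b → ⟦ lookup M u ∧ b ⟧) (lookup∘tabulate _ u) ⟩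
  ⟦ lookup M u ∧ does (adj? G v u) ⟧     ≡⟨ ⟦∧⟧ (lookup M u) _ ⟩
  ⟦ lookup M u ⟧ * edge G v u            ≡⟨ *-comm ⟦ lookup M u ⟧ _ ⟩
  edge G v u * ⟦ lookup M u ⟧            ∎)
  where open ≡-Reasoning

monopoly-lower-bound : (G : Graph) (t Δ : ℕ) (M : Subset (order G)) →
  (∀ u → ∑[ v < order G ] edge G v u ≤ Δ) → IsMonopoly G (const G t) M →
  t * ∣ ∁ M ∣ ≤ Δ * ∣ M ∣
monopoly-lower-bound G t Δ M indegree≤Δ monopoly = begin
  t * ∣ ∁ M ∣
    ≡⟨ cong (t *_) (trans (∣p∣≡∑ (∁ M)) (sum-cong-≗ λ v → cong ⟦_⟧ (lookup-map v not M))) ⟩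
  t * ∑[ v < N ] ⟦ not (lookup M v) ⟧
    ≡⟨ *-distribˡ-sum t (λ v → ⟦ not (lookup M v) ⟧) ⟩
  ∑[ v < N ] (t * ⟦ not (lookup M v) ⟧)
    ≤⟨ sum-mono-≤ outside-has-t ⟩
  ∑[ v < N ] ∣ M ∩ Nbhd G v ∣
    ≡⟨ sum-cong-≗ (∣M∩Nbhd∣≡∑ G M) ⟩
  ∑[ v < N ] ∑[ u < N ] (edge G v u * ⟦ lookup M u ⟧)
    ≡⟨ ∑-comm (λ v u → edge G v u * ⟦ lookup M u ⟧) ⟩
  ∑[ u < N ] ∑[ v < N ] (edge G v u * ⟦ lookup M u ⟧)
    ≡⟨ sum-cong-≗ (λ u → sym (*-distribʳ-sum ⟦ lookup M u ⟧ (λ v → edge G v u))) ⟩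
  ∑[ u < N ] (∑[ v < N ] edge G v u * ⟦ lookup M u ⟧)
    ≤⟨ sum-mono-≤ (λ u → *-monoˡ-≤ ⟦ lookup M u ⟧ (indegree≤Δ u)) ⟩
  ∑[ u < N ] (Δ * ⟦ lookup M u ⟧)
    ≡⟨ sym (*-distribˡ-sum Δ (λ u → ⟦ lookup M u ⟧)) ⟩
  Δ * ∑[ u < N ] ⟦ lookup M u ⟧
    ≡⟨ cong (Δ *_) (sym (∣p∣≡∑ M)) ⟩
  Δ * ∣ M ∣ ∎
  where
  open ≤-Reasoning
  N = order G
  outside-has-t : ∀ v → t * ⟦ not (lookup M v) ⟧ ≤ ∣ M ∩ Nbhd G v ∣
  outside-has-t v with lookup M v in M[v]
  ... | true = ≤-trans (≤-reflexive (*-zeroʳ t)) z≤n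
  ... | false = ≤-trans (≤-reflexive (*-identityʳ t))
                  (monopoly v λ v∈M → case trans (sym ([]=⇒lookup v∈M)) M[v] of λ ())

-- Cartesian products

□-indegree : (G H : Graph) (ΔG ΔH : ℕ) →
  (∀ c → ∑[ a < order G ] edge G a c ≤ ΔG) → (∀ d → ∑[ b < order H ] edge H b d ≤ ΔH) →
  ∀ u → ∑[ v < order (G □ H) ] edge (G □ H) v u ≤ ΔG + ΔH
□-indegree G H ΔG ΔH indegreeG indegreeH u = begin
  ∑[ v < m * k ] edge (G □ H) v u
    ≤⟨ sum-mono-≤ edge-□≤ ⟩
  ∑[ v < m * k ] (inRow (remQuot {m} k v) + inColumn (remQuot {m} k v))
    ≡⟨ ∑-remQuot m k (λ ab → inRow ab + inColumn ab) ⟩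
  ∑[ a < m ] ∑[ b < k ] (inRow (a , b) + inColumn (a , b))
    ≡⟨ sum-cong-≗ (λ a → ∑-distrib-+ (λ b → inRow (a , b)) (λ b → inColumn (a , b))) ⟩
  ∑[ a < m ] (∑[ b < k ] inRow (a , b) + ∑[ b < k ] inColumn (a , b))
    ≡⟨ ∑-distrib-+ (λ a → ∑[ b < k ] inRow (a , b)) (λ a → ∑[ b < k ] inColumn (a , b)) ⟩
  ∑[ a < m ] ∑[ b < k ] inRow (a , b) + ∑[ a < m ] ∑[ b < k ] inColumn (a , b)
    ≡⟨ cong₂ _+_ row-sum column-sum ⟩
  ∑[ b < k ] edge H b d + ∑[ a < m ] edge G a c
    ≤⟨ +-mono-≤ (indegreeH d) (indegreeG c) ⟩
  ΔH + ΔG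
    ≡⟨ +-comm ΔH ΔG ⟩
  ΔG + ΔH ∎
  where
  open ≤-Reasoning
  m = order G
  k = order H
  c = proj₁ (remQuot {m} k u)
  d = proj₂ (remQuot {m} k u)
  inRow inColumn : Fin m × Fin k → ℕ
  inRow (a , b) = ⟦ does (a Finₚ.≟ c) ⟧ * edge H b d
  inColumn (a , b) = ⟦ does (b Finₚ.≟ d) ⟧ * edge G a c
  edge-□≤ : ∀ v → edge (G □ H) v u ≤ inRow (remQuot {m} k v) + inColumn (remQuot {m} k v)
  edge-□≤ v = ≤-trans (⟦∨⟧≤ (does (a Finₚ.≟ c) ∧ does (adj? H b d)) _)
                      (+-mono-≤ (≤-reflexive (⟦∧⟧ (does (a Finₚ.≟ c)) (does (adj? H b d))))
                                (≤-reflexive (⟦∧⟧ (does (b Finₚ.≟ d)) (does (adj? G a c)))))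
    where
    a = proj₁ (remQuot {m} k v)
    b = proj₂ (remQuot {m} k v)
  row-sum : ∑[ a < m ] ∑[ b < k ] inRow (a , b) ≡ ∑[ b < k ] edge H b d
  row-sum = trans (sum-cong-≗ λ a → sym (*-distribˡ-sum ⟦ does (a Finₚ.≟ c) ⟧ (λ b → edge H b d)))
                  (∑-δ c (λ _ → ∑[ b < k ] edge H b d))
  column-sum : ∑[ a < m ] ∑[ b < k ] inColumn (a , b) ≡ ∑[ a < m ] edge G a c
  column-sum = sum-cong-≗ λ a → ∑-δ d (λ _ → edge G a c)

module _ (G H : Graph) (v : Fin (order G * order H)) where

  private
    a = proj₁ (remQuot {order G} (order H) v)
    b = proj₂ (remQuot {order G} (order H) v)
    □Adj-at : Fin (order G) × Fin (order H) → Set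
    □Adj-at (a′ , b′) = ((a ≡ a′) × Adj H b b′) ⊎ ((b ≡ b′) × Adj G a a′)

  □-adjacent-row : ∀ {b′} → Adj H b b′ → Adj (G □ H) v (combine a b′)
  □-adjacent-row {b′} b~b′ = subst □Adj-at (sym (Finₚ.remQuot-combine a b′)) (inj₁ (refl , b~b′))

  □-adjacent-column : ∀ {a′} → Adj G a a′ → Adj (G □ H) v (combine a′ b)
  □-adjacent-column {a′} a~a′ = subst □Adj-at (sym (Finₚ.remQuot-combine a′ b)) (inj₂ (refl , a~a′))

-- Cycles

next : ∀ {n} → Fin n → Fin n
next {n} j with suc (toℕ j) <? n
... | yes j+1<n = fromℕ< j+1<n
... | no _ = fromℕ< {0} (≤-trans (s≤s z≤n) (Finₚ.toℕ<n j))

prev : ∀ {n} → Fin n → Fin n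
prev {suc m} zero = fromℕ m
prev {suc m} (suc j) = inject₁ j

toℕ-next : ∀ {n} (j : Fin n) →
  (suc (toℕ j) < n × toℕ (next j) ≡ suc (toℕ j)) ⊎ (suc (toℕ j) ≡ n × toℕ (next j) ≡ 0)
toℕ-next {n} j with suc (toℕ j) <? n
... | yes j+1<n = inj₁ (j+1<n , Finₚ.toℕ-fromℕ< j+1<n)
... | no j+1≮n = inj₂ (≤-antisym (Finₚ.toℕ<n j) (≮⇒≥ j+1≮n) , Finₚ.toℕ-fromℕ< _)

toℕ-prev : ∀ {n} (j : Fin n) →
  (toℕ j ≡ 0 × suc (toℕ (prev j)) ≡ n) ⊎ (toℕ j ≡ suc (toℕ (prev j)))
toℕ-prev {suc m} zero = inj₁ (refl , cong suc (Finₚ.toℕ-fromℕ m))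
toℕ-prev {suc m} (suc j) = inj₂ (cong suc (sym (Finₚ.toℕ-inject₁ j)))

next-adjacent : ∀ {n} (j : Fin n) → CAdj n j (next j)
next-adjacent j with toℕ-next j
... | inj₁ (_ , next≡j+1) = inj₁ next≡j+1
... | inj₂ (j+1≡n , next≡0) = inj₂ (inj₂ (inj₂ (next≡0 , j+1≡n)))

prev-adjacent : ∀ {n} (j : Fin n) → CAdj n j (prev j)
prev-adjacent j with toℕ-prev j
... | inj₁ (j≡0 , p+1≡n) = inj₂ (inj₂ (inj₁ (j≡0 , p+1≡n)))
... | inj₂ j≡p+1 = inj₂ (inj₁ j≡p+1)

cycle-adjacent⇒next⊎prev : ∀ {n} (b d : Fin n) → CAdj n b d → b ≡ next d ⊎ b ≡ prev d
cycle-adjacent⇒next⊎prev b d (inj₁ d≡b+1) with toℕ-prev d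
... | inj₁ (d≡0 , _) = contradiction (trans (sym d≡0) d≡b+1) 0≢1+n
... | inj₂ d≡p+1 = inj₂ (Finₚ.toℕ-injective (suc-injective (trans (sym d≡b+1) d≡p+1)))
cycle-adjacent⇒next⊎prev b d (inj₂ (inj₁ b≡d+1)) with toℕ-next d
... | inj₁ (_ , next≡d+1) = inj₁ (Finₚ.toℕ-injective (trans b≡d+1 (sym next≡d+1)))
... | inj₂ (d+1≡n , _) = contradiction (trans b≡d+1 d+1≡n) (<⇒≢ (Finₚ.toℕ<n b))
cycle-adjacent⇒next⊎prev b d (inj₂ (inj₂ (inj₁ (b≡0 , d+1≡n)))) with toℕ-next d
... | inj₁ (d+1<n , _) = contradiction d+1≡n (<⇒≢ d+1<n)
... | inj₂ (_ , next≡0) = inj₁ (Finₚ.toℕ-injective (trans b≡0 (sym next≡0)))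
cycle-adjacent⇒next⊎prev b d (inj₂ (inj₂ (inj₂ (d≡0 , b+1≡n)))) with toℕ-prev d
... | inj₁ (_ , p+1≡n) = inj₂ (Finₚ.toℕ-injective (suc-injective (trans b+1≡n (sym p+1≡n))))
... | inj₂ d≡p+1 = contradiction (trans (sym d≡0) d≡p+1) 0≢1+n

cycle-indegree : ∀ n (d : Fin n) → ∑[ b < n ] edge (cycle n) b d ≤ 2
cycle-indegree n d = begin
  ∑[ b < n ] edge (cycle n) b d
    ≤⟨ sum-mono-≤ (λ b → edge≤ b (adj? (cycle n) b d)) ⟩
  ∑[ b < n ] (⟦ does (b Finₚ.≟ next d) ⟧ + ⟦ does (b Finₚ.≟ prev d) ⟧)
    ≡⟨ ∑-distrib-+ (λ b → ⟦ does (b Finₚ.≟ next d) ⟧) (λ b → ⟦ does (b Finₚ.≟ prev d) ⟧) ⟩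
  ∑[ b < n ] ⟦ does (b Finₚ.≟ next d) ⟧ + ∑[ b < n ] ⟦ does (b Finₚ.≟ prev d) ⟧
    ≡⟨ cong₂ _+_ (∑-point (next d)) (∑-point (prev d)) ⟩
  2 ∎
  where
  open ≤-Reasoning
  ∑-point : ∀ v → ∑[ b < n ] ⟦ does (b Finₚ.≟ v) ⟧ ≡ 1
  ∑-point v = trans (sum-cong-≗ λ b → sym (*-identityʳ ⟦ does (b Finₚ.≟ v) ⟧)) (∑-δ v (λ _ → 1))
  edge≤ : ∀ b (b~d? : Dec (CAdj n b d)) →
          ⟦ does b~d? ⟧ ≤ ⟦ does (b Finₚ.≟ next d) ⟧ + ⟦ does (b Finₚ.≟ prev d) ⟧
  edge≤ b (no _) = z≤n
  edge≤ b (yes b~d) with cycle-adjacent⇒next⊎prev b d b~d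
  ... | inj₁ b≡next rewrite dec-true (b Finₚ.≟ next d) b≡next = s≤s z≤n
  ... | inj₂ b≡prev rewrite dec-true (b Finₚ.≟ prev d) b≡prev = m≤n+m 1 _

3≤⇒≢1 : ∀ {n} → 3 ≤ n → n ≢ 1
3≤⇒≢1 (s≤s ()) refl

3≤⇒≢2 : ∀ {n} → 3 ≤ n → n ≢ 2
3≤⇒≢2 (s≤s (s≤s ())) refl

module _ {n} (3≤n : 3 ≤ n) where

  next≢id : (j : Fin n) → next j ≢ j
  next≢id j next≡j with toℕ-next j
  ... | inj₁ (_ , next≡j+1) = 1+n≢n (trans (sym next≡j+1) (cong toℕ next≡j))
  ... | inj₂ (j+1≡n , next≡0) =
    3≤⇒≢1 3≤n (trans (sym j+1≡n) (cong suc (trans (sym (cong toℕ next≡j)) next≡0)))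

  prev≢id : (j : Fin n) → prev j ≢ j
  prev≢id j prev≡j with toℕ-prev j
  ... | inj₁ (j≡0 , p+1≡n) = 3≤⇒≢1 3≤n (trans (sym p+1≡n) (cong suc (trans (cong toℕ prev≡j) j≡0)))
  ... | inj₂ j≡p+1 = 1+n≢n (trans (sym j≡p+1) (sym (cong toℕ prev≡j)))

  next≢prev : (j : Fin n) → next j ≢ prev j
  next≢prev j next≡prev with toℕ-next j | toℕ-prev j | cong toℕ next≡prev
  ... | inj₁ (_ , next≡j+1) | inj₁ (j≡0 , p+1≡n) | next≡p =
    3≤⇒≢2 3≤n (trans (sym p+1≡n) (cong suc (trans (sym next≡p) (trans next≡j+1 (cong suc j≡0)))))
  ... | inj₁ (_ , next≡j+1) | inj₂ j≡p+1 | next≡p =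
    <⇒≢ (m<n+m _ (s≤s z≤n)) (trans (sym next≡p) (trans next≡j+1 (cong suc j≡p+1)))
  ... | inj₂ (j+1≡n , _) | inj₁ (j≡0 , _) | _ = 3≤⇒≢1 3≤n (trans (sym j+1≡n) (cong suc j≡0))
  ... | inj₂ (j+1≡n , next≡0) | inj₂ j≡p+1 | next≡p =
    3≤⇒≢2 3≤n (trans (sym j+1≡n) (cong suc (trans j≡p+1 (cong suc (trans (sym next≡p) next≡0)))))

-- The torus Cₙ □ Cₙ

torus-neighbours : ∀ {n} → Fin (n * n) → List (Fin (n * n))
torus-neighbours {n} v = combine a (next b) ∷ combine a (prev b) ∷ combine (next a) b ∷ combine (prev a) b ∷ []
  where
  a = proj₁ (remQuot {n} n v)
  b = proj₂ (remQuot {n} n v)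

torus-neighbours-adjacent : ∀ {n} (v : Fin (n * n)) → All (Adj (cycle n □ cycle n) v) (torus-neighbours {n} v)
torus-neighbours-adjacent {n} v =
  □-adjacent-row Cₙ Cₙ v (next-adjacent b) ∷ □-adjacent-row Cₙ Cₙ v (prev-adjacent b) ∷
  □-adjacent-column Cₙ Cₙ v (next-adjacent a) ∷ □-adjacent-column Cₙ Cₙ v (prev-adjacent a) ∷ []
  where
  Cₙ = cycle n
  a = proj₁ (remQuot {n} n v)
  b = proj₂ (remQuot {n} n v)

torus-neighbours-unique : ∀ {n} → 3 ≤ n → (v : Fin (n * n)) → Unique (torus-neighbours {n} v)
torus-neighbours-unique {n} 3≤n v =
  (next≢prev 3≤n b ∘ Finₚ.combine-injectiveʳ a (next b) a (prev b) ∷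
   next≢id 3≤n a ∘ sym ∘ Finₚ.combine-injectiveˡ a (next b) (next a) b ∷
   prev≢id 3≤n a ∘ sym ∘ Finₚ.combine-injectiveˡ a (next b) (prev a) b ∷ []) ∷
  (next≢id 3≤n a ∘ sym ∘ Finₚ.combine-injectiveˡ a (prev b) (next a) b ∷
   prev≢id 3≤n a ∘ sym ∘ Finₚ.combine-injectiveˡ a (prev b) (prev a) b ∷ []) ∷
  (next≢prev 3≤n a ∘ Finₚ.combine-injectiveˡ (next a) b (prev a) b ∷ []) ∷
  [] ∷ []
  where
  a = proj₁ (remQuot {n} n v)
  b = proj₂ (remQuot {n} n v)

torus-monopoly-lower-bound : ∀ n (M : Subset (n * n)) →
  IsMonopoly (cycle n □ cycle n) (const (cycle n □ cycle n) 2) M → (n * n) / 3 ≤ ∣ M ∣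
torus-monopoly-lower-bound n M monopoly = begin
  (n * n) / 3      ≤⟨ /-monoˡ-≤ 3 n²≤3m ⟩
  (m * 3) / 3      ≡⟨ m*n/n≡m m 3 ⟩
  m                ∎
  where
  open ≤-Reasoning
  m = ∣ M ∣
  outside≤2m : ∣ ∁ M ∣ ≤ 2 * m
  outside≤2m = *-cancelˡ-≤ 2 (≤-trans
    (monopoly-lower-bound (cycle n □ cycle n) 2 4 M
      (□-indegree (cycle n) (cycle n) 2 2 (cycle-indegree n) (cycle-indegree n)) monopoly)
    (≤-reflexive (*-assoc 2 2 m)))
  n²≤3m : n * n ≤ m * 3
  n²≤3m = begin
    n * n          ≡⟨ sym (trans (cong (_+ m) (∣∁p∣≡n∸∣p∣ M)) (m∸n+n≡m (∣p∣≤n M))) ⟩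
    ∣ ∁ M ∣ + m    ≤⟨ +-monoˡ-≤ m outside≤2m ⟩
    2 * m + m      ≡⟨ trans (+-comm (2 * m) m) (*-comm 3 m) ⟩
    m * 3          ∎

-- The construction

%3-suc : ∀ j → suc j % 3 ≡ suc (j % 3) % 3
%3-suc j = %-distribˡ-+ 1 j 3

%3-pred : ∀ j → j % 3 ≡ (suc j % 3 + 2) % 3
%3-pred j = begin
  j % 3                ≡⟨ sym ([m+n]%n≡m%n j 3) ⟩
  (j + 3) % 3          ≡⟨ cong (_% 3) (+-suc j 2) ⟩
  (suc j + 2) % 3      ≡⟨ %-distribˡ-+ (suc j) 2 3 ⟩
  (suc j % 3 + 2) % 3  ∎
  where open ≡-Reasoning

%3-last : ∀ t e j → suc j ≡ 3 * t + e → j % 3 ≡ (e + 2) % 3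
%3-last t e j j+1≡n = begin
  j % 3                ≡⟨ sym ([m+kn]%n≡m%n j 1 3) ⟩
  (j + 3) % 3          ≡⟨ cong (_% 3) (trans (+-suc j 2) (cong (_+ 2) j+1≡n)) ⟩
  (3 * t + e + 2) % 3  ≡⟨ cong (_% 3) (rearrange t e) ⟩
  (e + 2 + t * 3) % 3  ≡⟨ [m+kn]%n≡m%n (e + 2) t 3 ⟩
  (e + 2) % 3          ∎
  where
  open ≡-Reasoning
  rearrange : ∀ t e → 3 * t + e + 2 ≡ e + 2 + t * 3
  rearrange = solve-∀

data Place : Set where
  first second last : Place
  interior : Fin 3 → Place

place : ℕ → ℕ → Place
place n zero = first
place n (suc zero) = second
place n j@(suc (suc _)) = if suc j ≡ᵇ n then last else interior (j mod 3)

isFirst isSecond isLast : Place → Bool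
isFirst first = true
isFirst _ = false
isSecond second = true
isSecond _ = false
isLast last = true
isLast _ = false

-- For n = 3t + e the last coordinate n − 1 is congruent to e + 2.
residue : ℕ → Place → ℕ
residue e first = 0
residue e second = 1
residue e last = (e + 2) % 3
residue e (interior r) = toℕ r

isFirst-place : ∀ n j → isFirst (place n j) ≡ (j ≡ᵇ 0)
isFirst-place n zero = refl
isFirst-place n (suc zero) = refl
isFirst-place n (suc (suc k)) with suc (suc (suc k)) ≡ᵇ n
... | true = refl
... | false = refl

isSecond-place-suc : ∀ n j → isSecond (place n (suc j)) ≡ (j ≡ᵇ 0)
isSecond-place-suc n zero = refl
isSecond-place-suc n (suc k) with suc (suc (suc k)) ≡ᵇ n
... | true = refl
... | false = refl

residue-place : ∀ {n e} t → n ≡ 3 * t + e → ∀ j → residue e (place n j) ≡ j % 3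
residue-place t n≡3t+e zero = refl
residue-place t n≡3t+e (suc zero) = refl
residue-place {n} {e} t n≡3t+e j@(suc (suc k)) with suc j ≡ᵇ n in j+1≟n
... | true = sym (%3-last t e j (trans (≡ᵇ⇒≡ (suc j) n (Equivalence.from T-≡ j+1≟n)) n≡3t+e))
... | false = Finₚ.toℕ-fromℕ< (m%n<n j 3)

place-last : ∀ {n j} → 3 ≤ n → suc j ≡ n → place n j ≡ last
place-last {j = zero} (s≤s ()) refl
place-last {j = suc zero} (s≤s (s≤s ())) refl
place-last {n} {suc (suc k)} _ j+1≡n rewrite Equivalence.to T-≡ (≡⇒≡ᵇ _ n j+1≡n) = refl

isLast-place : ∀ {n j} → suc j < n → isLast (place n j) ≡ false
isLast-place {j = zero} _ = refl
isLast-place {j = suc zero} _ = refl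
isLast-place {n} {suc (suc k)} j+1<n with suc (suc (suc k)) ≡ᵇ n in j+1≟n
... | true = contradiction (≡ᵇ⇒≡ _ n (Equivalence.from T-≡ j+1≟n)) (<⇒≢ j+1<n)
... | false = refl

Label : Set
Label = Bool × ℕ

label : ℕ → Label
label j = ((j ≡ᵇ 0) , j % 3)

labelAt labelNext labelPrev : ℕ → Place → Label
labelAt e p = (isFirst p , residue e p)
labelNext e p = (isLast p , (if isLast p then 0 else suc (residue e p) % 3))
labelPrev e p = (isSecond p , (if isFirst p then residue e last else (residue e p + 2) % 3))

diagonal : ℕ → ℕ → Bool
diagonal ri rj = (ri + rj) % 3 ≡ᵇ 1

onAxis : ℕ → Label → Bool
onAxis 1 (z , r) = (r ≡ᵇ 0) ∧ not z
onAxis 2 (z , r) = r ≡ᵇ 2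
onAxis _ _ = false

member : ℕ → Label → Label → Bool
member e x@(zi , ri) y@(zj , rj) = diagonal ri rj ∨ (zi ∧ onAxis e y) ∨ (zj ∧ onAxis e x)

memberAt : ∀ {n} → ℕ → Fin n × Fin n → Bool
memberAt e (a , b) = member e (label (toℕ a)) (label (toℕ b))

construction : ∀ n → ℕ → Subset (n * n)
construction n e = tabulate (memberAt e ∘ remQuot n)

lookup-construction : ∀ {n} e (a b : Fin n) → lookup (construction n e) (combine a b) ≡ memberAt e (a , b)
lookup-construction {n} e a b =
  trans (lookup∘tabulate (memberAt e ∘ remQuot n) (combine a b)) (cong (memberAt e) (Finₚ.remQuot-combine a b))

neighbourMembers : ℕ → Place → Place → List Bool
neighbourMembers e p q =
  member e (labelAt e p) (labelNext e q) ∷ member e (labelAt e p) (labelPrev e q) ∷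
  member e (labelNext e p) (labelAt e q) ∷ member e (labelPrev e p) (labelAt e q) ∷ []

covered : ℕ → Place → Place → Bool
covered e p q = member e (labelAt e p) (labelAt e q) ∨ (2 ≤ᵇ sumˡ (List.map ⟦_⟧ (neighbourMembers e p q)))

places : List Place
places = first ∷ second ∷ last ∷ interior zero ∷ interior (suc zero) ∷ interior (suc (suc zero)) ∷ []

∈-places : ∀ p → p ∈ˡ places
∈-places first = here refl
∈-places second = there (here refl)
∈-places last = there (there (here refl))
∈-places (interior zero) = there (there (there (here refl)))
∈-places (interior (suc zero)) = there (there (there (there (here refl))))
∈-places (interior (suc (suc zero))) = there (there (there (there (there (here refl)))))

∈-upTo3 : ∀ {e} → e < 3 → e ∈ˡ List.upTo 3
∈-upTo3 {0} _ = here refl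
∈-upTo3 {1} _ = there (here refl)
∈-upTo3 {2} _ = there (there (here refl))
∈-upTo3 {suc (suc (suc _))} (s≤s (s≤s (s≤s ())))

covered-everywhere : ∀ {e} → e < 3 → ∀ p q → T (covered e p q)
covered-everywhere e<3 p q = All.lookup (All.lookup (All.lookup table (∈-upTo3 e<3)) (∈-places p)) (∈-places q)
  where
  table : All (λ e → All (λ p → All (λ q → T (covered e p q)) places) places) (List.upTo 3)
  table = from-yes (All.all? (λ e → All.all? (λ p → All.all? (λ q → T? (covered e p q)) places) places) (List.upTo 3))

module _ {n e} (t : ℕ) (3≤n : 3 ≤ n) (n≡3t+e : n ≡ 3 * t + e) where

  label-place : ∀ j → label j ≡ labelAt e (place n j)
  label-place j = cong₂ _,_ (sym (isFirst-place n j)) (sym (residue-place t n≡3t+e j))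

  label-next : (j : Fin n) → label (toℕ (next j)) ≡ labelNext e (place n (toℕ j))
  label-next j with toℕ-next j
  ... | inj₁ (j+1<n , next≡j+1) rewrite next≡j+1 | isLast-place {n} j+1<n =
    cong (false ,_) (trans (%3-suc (toℕ j)) (cong (λ r → suc r % 3) (sym (residue-place t n≡3t+e (toℕ j)))))
  ... | inj₂ (j+1≡n , next≡0) rewrite next≡0 | place-last 3≤n j+1≡n = refl

  label-prev : (j : Fin n) → label (toℕ (prev j)) ≡ labelPrev e (place n (toℕ j))
  label-prev j with toℕ-prev j
  ... | inj₁ (j≡0 , p+1≡n) rewrite j≡0 = cong₂ _,_
    (dec-false (toℕ (prev j) ≟ 0) λ p≡0 → 3≤⇒≢1 3≤n (trans (sym p+1≡n) (cong suc p≡0)))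
    (%3-last t e (toℕ (prev j)) (trans p+1≡n n≡3t+e))
  ... | inj₂ j≡p+1 rewrite j≡p+1 | isFirst-place n (suc (toℕ (prev j))) = cong₂ _,_
    (sym (isSecond-place-suc n (toℕ (prev j))))
    (trans (%3-pred (toℕ (prev j))) (cong (λ r → (r + 2) % 3) (sym (residue-place t n≡3t+e (suc (toℕ (prev j)))))))

  module _ (v : Fin (n * n)) where

    private
      a = proj₁ (remQuot {n} n v)
      b = proj₂ (remQuot {n} n v)

    lookup-construction-at : lookup (construction n e) v ≡
      member e (labelAt e (place n (toℕ a))) (labelAt e (place n (toℕ b)))
    lookup-construction-at = trans (lookup∘tabulate (memberAt e ∘ remQuot n) v)
      (cong₂ (member e) (label-place (toℕ a)) (label-place (toℕ b)))

    lookup-construction-neighbours : List.map (lookup (construction n e)) (torus-neighbours {n} v) ≡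
      neighbourMembers e (place n (toℕ a)) (place n (toℕ b))
    lookup-construction-neighbours =
      cong₂ _∷_ (at a (next b) (label-place (toℕ a)) (label-next b)) (
      cong₂ _∷_ (at a (prev b) (label-place (toℕ a)) (label-prev b)) (
      cong₂ _∷_ (at (next a) b (label-next a) (label-place (toℕ b))) (
      cong₂ _∷_ (at (prev a) b (label-prev a) (label-place (toℕ b))) refl)))
      where
      at : ∀ a′ b′ {x y} → label (toℕ a′) ≡ x → label (toℕ b′) ≡ y →
           lookup (construction n e) (combine a′ b′) ≡ member e x y
      at a′ b′ refl refl = lookup-construction e a′ b′

construction-monopoly : ∀ {n e} t → 3 ≤ n → e < 3 → n ≡ 3 * t + e →
  IsMonopoly (cycle n □ cycle n) (const (cycle n □ cycle n) 2) (construction n e)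
construction-monopoly {n} {e} t 3≤n e<3 n≡3t+e v v∉M = begin
  2                                               ≤⟨ ≤ᵇ⇒≤ 2 _ two-neighbours ⟩
  sumˡ (List.map ⟦_⟧ (neighbourMembers e p q))    ≡⟨ cong (sumˡ ∘ List.map ⟦_⟧) (sym neighbours-in-S) ⟩
  sumˡ (List.map (⟦_⟧ ∘ lookup S) ws)             ≤⟨ sum-unique≤∑ (⟦_⟧ ∘ lookup S) (torus-neighbours-unique 3≤n v) ⟩
  ∑[ w < n * n ] ⟦ lookup S w ⟧                   ≡⟨ sym (∣p∣≡∑ S) ⟩
  ∣ S ∣                                           ∎
  where
  open ≤-Reasoning
  Tₙ = cycle n □ cycle n
  M = construction n e
  S = M ∩ Nbhd Tₙ v
  ws = torus-neighbours {n} v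
  p = place n (toℕ (proj₁ (remQuot {n} n v)))
  q = place n (toℕ (proj₂ (remQuot {n} n v)))
  two-neighbours : T (2 ≤ᵇ sumˡ (List.map ⟦_⟧ (neighbourMembers e p q)))
  two-neighbours = subst (λ self → T (self ∨ (2 ≤ᵇ sumˡ (List.map ⟦_⟧ (neighbourMembers e p q)))))
    (trans (sym (lookup-construction-at t 3≤n n≡3t+e v)) (∉⇒lookup≡false v∉M))
    (covered-everywhere e<3 p q)
  neighbours-in-S : List.map (lookup S) ws ≡ neighbourMembers e p q
  neighbours-in-S = trans (map-cong-local (All.map (lookup-∩-Nbhd Tₙ M) (torus-neighbours-adjacent v)))
                          (lookup-construction-neighbours t 3≤n n≡3t+e v)

-- Counting the construction

diagonalCount : ℕ → ℕ
diagonalCount n = ∑[ a < n ] ∑[ b < n ] ⟦ diagonal (toℕ a % 3) (toℕ b % 3) ⟧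

axisCount : ℕ → ℕ → ℕ
axisCount n e = ∑[ j < n ] ⟦ onAxis e (label (toℕ j)) ⟧

∑-at-zero≤ : ∀ {n} x → ∑[ b < n ] ⟦ (toℕ b ≡ᵇ 0) ∧ x ⟧ ≤ ⟦ x ⟧
∑-at-zero≤ {zero} x = z≤n
∑-at-zero≤ {suc n} x = ≤-reflexive (trans (cong (⟦ x ⟧ +_) (sum-replicate-zero n)) (+-identityʳ ⟦ x ⟧))

∣construction∣≤ : ∀ n e → ∣ construction n e ∣ ≤ diagonalCount n + (axisCount n e + axisCount n e)
∣construction∣≤ n e = begin
  ∣ construction n e ∣
    ≡⟨ trans (∣p∣≡∑ (construction n e)) (sum-cong-≗ λ x → cong ⟦_⟧ (lookup∘tabulate (memberAt e ∘ remQuot n) x)) ⟩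
  ∑[ x < n * n ] ⟦ memberAt e (remQuot n x) ⟧
    ≤⟨ sum-mono-≤ (λ x → member≤ (remQuot n x)) ⟩
  ∑[ x < n * n ] (D (remQuot n x) + (R (remQuot n x) + C (remQuot n x)))
    ≡⟨ trans (∑-distrib-+ (D ∘ remQuot n) (λ x → R (remQuot n x) + C (remQuot n x)))
             (cong (∑[ x < n * n ] D (remQuot n x) +_) (∑-distrib-+ (R ∘ remQuot n) (C ∘ remQuot n))) ⟩
  ∑[ x < n * n ] D (remQuot n x) + (∑[ x < n * n ] R (remQuot n x) + ∑[ x < n * n ] C (remQuot n x))
    ≡⟨ cong₂ _+_ (∑-remQuot n n D) (cong₂ _+_ (∑-remQuot n n R) (∑-remQuot n n C)) ⟩
  diagonalCount n + (∑[ a < n ] ∑[ b < n ] R (a , b) + ∑[ a < n ] ∑[ b < n ] C (a , b))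
    ≤⟨ +-monoʳ-≤ (diagonalCount n) (+-mono-≤ row≤ column≤) ⟩
  diagonalCount n + (axisCount n e + axisCount n e) ∎
  where
  open ≤-Reasoning
  D R C : Fin n × Fin n → ℕ
  D (a , b) = ⟦ diagonal (toℕ a % 3) (toℕ b % 3) ⟧
  R (a , b) = ⟦ (toℕ a ≡ᵇ 0) ∧ onAxis e (label (toℕ b)) ⟧
  C (a , b) = ⟦ (toℕ b ≡ᵇ 0) ∧ onAxis e (label (toℕ a)) ⟧
  member≤ : ∀ ab → ⟦ memberAt e ab ⟧ ≤ D ab + (R ab + C ab)
  member≤ (a , b) =
    ≤-trans (⟦∨⟧≤ (diagonal (toℕ a % 3) (toℕ b % 3)) (row ∨ column)) (+-monoʳ-≤ (D (a , b)) (⟦∨⟧≤ row column))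
    where
    row = (toℕ a ≡ᵇ 0) ∧ onAxis e (label (toℕ b))
    column = (toℕ b ≡ᵇ 0) ∧ onAxis e (label (toℕ a))
  row≤ : ∑[ a < n ] ∑[ b < n ] R (a , b) ≤ axisCount n e
  row≤ = ≤-trans (≤-reflexive (∑-comm (λ a b → R (a , b))))
                 (sum-mono-≤ {n} λ b → ∑-at-zero≤ {n} (onAxis e (label (toℕ b))))
  column≤ : ∑[ a < n ] ∑[ b < n ] C (a , b) ≤ axisCount n e
  column≤ = sum-mono-≤ {n} λ a → ∑-at-zero≤ {n} (onAxis e (label (toℕ a)))

diagonal-row : ∀ t e {r} → r < 3 →
  ∑[ b < 3 * t + e ] ⟦ diagonal r (toℕ b % 3) ⟧ ≡ t + ∑[ b < e ] ⟦ diagonal r (toℕ b % 3) ⟧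
diagonal-row t e {r} r<3 = begin
  ∑[ b < 3 * t + e ] ⟦ diagonal r (toℕ b % 3) ⟧
    ≡⟨ ∑-periodic 3 (λ k → ⟦ diagonal r (k % 3) ⟧) (λ _ → refl) t e ⟩
  t * ∑[ b < 3 ] ⟦ diagonal r (toℕ b % 3) ⟧ + tail
    ≡⟨ cong (λ k → t * k + tail) (once-per-period r<3) ⟩
  t * 1 + tail
    ≡⟨ cong (_+ tail) (*-identityʳ t) ⟩
  t + tail ∎
  where
  open ≡-Reasoning
  tail = ∑[ b < e ] ⟦ diagonal r (toℕ b % 3) ⟧
  once-per-period : ∀ {r} → r < 3 → ∑[ b < 3 ] ⟦ diagonal r (toℕ b % 3) ⟧ ≡ 1
  once-per-period {0} _ = refl
  once-per-period {1} _ = refl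
  once-per-period {2} _ = refl
  once-per-period {suc (suc (suc _))} (s≤s (s≤s (s≤s ())))

diagonalTail : ℕ → ℕ → ℕ
diagonalTail e a = ∑[ b < e ] ⟦ diagonal (a % 3) (toℕ b % 3) ⟧

diagonalCount-periodic : ∀ t e → diagonalCount (3 * t + e) ≡
  (3 * t + e) * t + (t * ∑[ a < 3 ] diagonalTail e (toℕ a) + ∑[ a < e ] diagonalTail e (toℕ a))
diagonalCount-periodic t e = begin
  diagonalCount N
    ≡⟨ sum-cong-≗ {N} (λ a → diagonal-row t e (m%n<n (toℕ a) 3)) ⟩
  ∑[ a < N ] (t + diagonalTail e (toℕ a))
    ≡⟨ ∑-distrib-+ {N} (λ _ → t) (λ a → diagonalTail e (toℕ a)) ⟩
  ∑[ a < N ] t + ∑[ a < N ] diagonalTail e (toℕ a)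
    ≡⟨ cong₂ _+_ (∑-const N t) (∑-periodic 3 (diagonalTail e) (λ _ → refl) t e) ⟩
  N * t + (t * ∑[ a < 3 ] diagonalTail e (toℕ a) + ∑[ a < e ] diagonalTail e (toℕ a)) ∎
  where
  open ≡-Reasoning
  N = 3 * t + e

axisCount-0 : ∀ n → axisCount n 0 ≡ 0
axisCount-0 n = sum-replicate-zero n

axisCount-1 : ∀ t → axisCount (3 * t + 1) 1 ≡ t
axisCount-1 t = begin
  axisCount (3 * t + 1) 1        ≡⟨ cong (λ m → axisCount m 1) (+-comm (3 * t) 1) ⟩
  ∑[ k < 3 * t ] h (toℕ k)       ≡⟨ cong (λ m → ∑[ k < m ] h (toℕ k)) (sym (+-identityʳ (3 * t))) ⟩
  ∑[ k < 3 * t + 0 ] h (toℕ k)   ≡⟨ ∑-periodic 3 h (λ _ → refl) t 0 ⟩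
  t * 1 + 0                      ≡⟨ trans (+-identityʳ (t * 1)) (*-identityʳ t) ⟩
  t                              ∎
  where
  open ≡-Reasoning
  h : ℕ → ℕ
  h k = ⟦ onAxis 1 (label (suc k)) ⟧

axisCount-2 : ∀ t → axisCount (3 * t + 2) 2 ≡ t
axisCount-2 t = trans (∑-periodic 3 (λ k → ⟦ onAxis 2 (label k) ⟧) (λ _ → refl) t 2)
                      (trans (+-identityʳ (t * 1)) (*-identityʳ t))

≤⇒≤/3 : ∀ {m k N} → m ≤ k → k * 3 ≡ N → m ≤ N / 3
≤⇒≤/3 {k = k} m≤k k*3≡N = ≤-trans m≤k (≤-reflexive (trans (sym (m*n/n≡m k 3)) (cong (_/ 3) k*3≡N)))

-- In the three size bounds the sums over the first e rows and columns are closed terms and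
-- evaluate to the constants displayed.

construction-size-0 : ∀ {n} t → n ≡ 3 * t + 0 → ∣ construction n 0 ∣ ≤ (n * n) / 3
construction-size-0 t refl = ≤⇒≤/3 (begin
  ∣ construction N 0 ∣
    ≤⟨ ∣construction∣≤ N 0 ⟩
  diagonalCount N + (axisCount N 0 + axisCount N 0)
    ≡⟨ cong₂ _+_ (diagonalCount-periodic t 0) (cong₂ _+_ (axisCount-0 N) (axisCount-0 N)) ⟩
  N * t + (t * 0 + 0) + (0 + 0) ∎) (arithmetic t)
  where
  open ≤-Reasoning
  N = 3 * t + 0
  arithmetic : ∀ t → ((3 * t + 0) * t + (t * 0 + 0) + (0 + 0)) * 3 ≡ (3 * t + 0) * (3 * t + 0)
  arithmetic = solve-∀

construction-size-1 : ∀ {n} t → n ≡ 3 * t + 1 → ∣ construction n 1 ∣ ≤ ((n ∸ 1) * (n + 3)) / 3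
construction-size-1 t refl = ≤⇒≤/3 (begin
  ∣ construction N 1 ∣
    ≤⟨ ∣construction∣≤ N 1 ⟩
  diagonalCount N + (axisCount N 1 + axisCount N 1)
    ≡⟨ cong₂ _+_ (diagonalCount-periodic t 1) (cong₂ _+_ (axisCount-1 t) (axisCount-1 t)) ⟩
  N * t + (t * 1 + 0) + (t + t) ∎)
  (trans (arithmetic t) (cong (_* (N + 3)) (sym (m+n∸n≡m (3 * t) 1))))
  where
  open ≤-Reasoning
  N = 3 * t + 1
  arithmetic : ∀ t → ((3 * t + 1) * t + (t * 1 + 0) + (t + t)) * 3 ≡ 3 * t * (3 * t + 1 + 3)
  arithmetic = solve-∀

construction-size-2 : ∀ {n} t → n ≡ 3 * t + 2 → ∣ construction n 2 ∣ ≤ ((n + 1) * (n + 1)) / 3 ∸ 1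
construction-size-2 t refl = ≤-trans (begin
  ∣ construction N 2 ∣
    ≤⟨ ∣construction∣≤ N 2 ⟩
  diagonalCount N + (axisCount N 2 + axisCount N 2)
    ≡⟨ cong₂ _+_ (diagonalCount-periodic t 2) (cong₂ _+_ (axisCount-2 t) (axisCount-2 t)) ⟩
  K ∎)
  (≤-reflexive (cong (_∸ 1) (trans (sym (m*n/n≡m (suc K) 3)) (cong (_/ 3) (arithmetic t)))))
  where
  open ≤-Reasoning
  N = 3 * t + 2
  K = N * t + (t * 2 + 2) + (t + t)
  arithmetic : ∀ t → suc ((3 * t + 2) * t + (t * 2 + 2) + (t + t)) * 3 ≡ (3 * t + 2 + 1) * (3 * t + 2 + 1)
  arithmetic = solve-∀

theorem1 : (n : ℕ) → 3 ≤ n →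
    let G = cycle n □ cycle n in
      ((t : ℕ) → n ≡ 3 * t → MonEq G (const G 2) ((n * n) / 3))
      × ((t : ℕ) → n ≡ 3 * t + 1 → MonLe G (const G 2) (((n ∸ 1) * (n + 3)) / 3))
      × ((t : ℕ) → n ≡ 3 * t + 2 → MonLe G (const G 2) (((n + 1) * (n + 1)) / 3 ∸ 1))
theorem1 n 3≤n = divisible , remainder-1 , remainder-2
  where
  divisible : (t : ℕ) → n ≡ 3 * t → MonEq (cycle n □ cycle n) (const (cycle n □ cycle n) 2) ((n * n) / 3)
  divisible t n≡3t =
    (construction n 0 , monopoly , ≤-antisym (construction-size-0 t n≡3t+0) (lower-bound _ monopoly)) , lower-bound
    where
    n≡3t+0 = trans n≡3t (sym (+-identityʳ (3 * t)))
    monopoly = construction-monopoly t 3≤n (s≤s z≤n) n≡3t+0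
    lower-bound = torus-monopoly-lower-bound n
  remainder-1 = λ t n≡3t+1 →
    construction n 1 , construction-monopoly t 3≤n (s≤s (s≤s z≤n)) n≡3t+1 , construction-size-1 t n≡3t+1
  remainder-2 = λ t n≡3t+2 →
    construction n 2 , construction-monopoly t 3≤n (s≤s (s≤s (s≤s z≤n))) n≡3t+2 , construction-size-2 t n≡3t+2
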